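{- For any positive integers $C, D, n$ such that $C\cdot 2^{D+1} \leq \log n$, there exists a simultaneous multicast instance on an $n$-node graph with congestion $C$ and dilation $D$ whose optimal (shortest) schedule requires at least $\tfrac{CD}{2}$ rounds.
   Context: Store-and-forward model: a network is a simple undirected graph $G=(V,E)$ with $n$ nodes; time proceeds in synchronous rounds. In each round a node may send packets it holds (possibly copies, possibly to several neighbors) to neighbors in $G$, subject to the constraint that at most one packet crosses each edge per round. A simultaneous multicast instance is a collection $\mathcal{T}$ of rooted trees $T_i$ (subgraphs of $G$), each with root $r_i$, leaf set $L_i$, and a packet $m_i$ initially known only to $r_i$; $m_i$ may only be sent over edges of $T_i$. A schedule specifies which packets are sent over which edges in which rounds; its length is the number of rounds until, for every $i$, all nodes of $L_i$ have received $m_i$. The congestion is $C=\max_{e\in E}|\{i: e\in T_i\}|$ and the dilation is $D=\max_i \mathrm{depth}(T_i)$. -}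

module Defs where

open import Data.Nat using (ℕ; zero; suc; _+_; _≤_)
open import Data.Fin using (Fin; zero; suc; _≟_)
open import Data.Bool using (Bool; true; false; if_then_else_; _∧_; _∨_; not)
open import Data.Product using (Σ; _×_; _,_)
open import Data.Sum using (_⊎_)
open import Relation.Binary.PropositionalEquality using (_≡_; _≢_)
open import Relation.Nullary.Decidable using (⌊_⌋)
open import Function using (_∘_)

count : ∀ {k} → (Fin k → Bool) → ℕ
count {zero}  f = 0
count {suc k} f = (if f zero then 1 else 0) + count (f ∘ suc)

record Graph (n : ℕ) : Set where
  field
    adj    : Fin n → Fin n → Bool
    sym    : ∀ u v → adj u v ≡ adj v u
    irrefl : ∀ u → adj u u ≡ false
open Graph public

-- A rooted tree that is a subgraph of G, given by its vertex set,
-- its root, and parent pointers; 'level' is the depth of each vertex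
-- (it certifies acyclicity). Tree edges are {v , parent v} for
-- non-root tree vertices v.
record RootedTree {n : ℕ} (G : Graph n) : Set where
  field
    root          : Fin n
    member        : Fin n → Bool
    parent        : Fin n → Fin n
    level         : Fin n → ℕ
    root-member   : member root ≡ true
    root-level    : level root ≡ 0
    parent-member : ∀ v → member v ≡ true → v ≢ root → member (parent v) ≡ true
    parent-adj    : ∀ v → member v ≡ true → v ≢ root → adj G (parent v) v ≡ true
    parent-level  : ∀ v → member v ≡ true → v ≢ root → level v ≡ suc (level (parent v))
open RootedTree public

isChildOf : ∀ {n} {G : Graph n} → RootedTree G → Fin n → Fin n → Bool
isChildOf T v u = member T v ∧ not ⌊ v ≟ root T ⌋ ∧ ⌊ parent T v ≟ u ⌋

treeEdge : ∀ {n} {G : Graph n} → RootedTree G → Fin n → Fin n → Bool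
treeEdge T u v = isChildOf T v u ∨ isChildOf T u v

IsLeaf : ∀ {n} {G : Graph n} → RootedTree G → Fin n → Set
IsLeaf T v = member T v ≡ true × (∀ w → isChildOf T w v ≡ false)

-- A simultaneous multicast instance: k trees T_i; packet m_i starts at root T_i.
record Instance {n : ℕ} (G : Graph n) : Set where
  field
    k    : ℕ
    tree : Fin k → RootedTree G
open Instance public

load : ∀ {n} {G : Graph n} → Instance G → Fin n → Fin n → ℕ
load I u v = count (λ i → treeEdge (tree I i) u v)

HasCongestion : ∀ {n} {G : Graph n} → Instance G → ℕ → Set
HasCongestion {n} {G} I C =
  (∀ u v → adj G u v ≡ true → load I u v ≤ C) ×
  Σ (Fin n) λ u → Σ (Fin n) λ v → adj G u v ≡ true × load I u v ≡ C

HasDilation : ∀ {n} {G : Graph n} → Instance G → ℕ → Set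
HasDilation {n} {G} I D =
  (∀ i v → member (tree I i) v ≡ true → level (tree I i) v ≤ D) ×
  Σ (Fin (k I)) λ i → Σ (Fin n) λ v → member (tree I i) v ≡ true × level (tree I i) v ≡ D

-- send t i u v = true : in round t, (a copy of) packet m_i is sent from u to v
SendFn : ℕ → ℕ → Set
SendFn k n = ℕ → Fin k → Fin n → Fin n → Bool

-- Has s r t i u : node u holds packet m_i at the start of round t
Has : ∀ {k n} → SendFn k n → (Fin k → Fin n) → ℕ → Fin k → Fin n → Set
Has s r zero    i u = u ≡ r i
Has {n = n} s r (suc t) i u = Has s r t i u ⊎ Σ (Fin n) λ w → s t i w u ≡ true

SameEdge : ∀ {n} → Fin n → Fin n → Fin n → Fin n → Set
SameEdge u v u' v' = (u' ≡ u × v' ≡ v) ⊎ (u' ≡ v × v' ≡ u)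

-- a schedule of length len (rounds 0 , … , len - 1)
record Schedule {n : ℕ} {G : Graph n} (I : Instance G) (len : ℕ) : Set where
  field
    send       : SendFn (k I) n
    along-tree : ∀ t i u v → send t i u v ≡ true → treeEdge (tree I i) u v ≡ true
    holds      : ∀ t i u v → send t i u v ≡ true → Has send (λ j → root (tree I j)) t i u
    capacity   : ∀ t i j u v u' v' → send t i u v ≡ true → send t j u' v' ≡ true →
                 SameEdge u v u' v' → i ≡ j × u ≡ u' × v ≡ v'
    delivered  : ∀ i v → IsLeaf (tree I i) v → Has send (λ j → root (tree I j)) len i v

module Submission where

-- Construction (D = E + 1).  The level-0 gadget is one hub at which C trees
-- are rooted.  The level-(d+1) gadget is two copies of the level-d gadget plus
-- one hub for every choice of a level-d hub and a selector in each copy; a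
-- selector forwards at most C of the trees entering its hub.  Below every
-- level-E hub and selector hangs a terminal vertex.  The graph is the union of
-- the trees, every edge carries at most C of them, and counting vertices gives
-- at most 2^(C·2^(D+1)) nodes.
--
-- Let H = ⌊C/2⌋.  By capacity at most H packets cross an edge in
-- H rounds, so of C trees late at each of the two hubs below a new hub, at
-- least 2(C - H) ≥ C are still late H + 1 rounds later, and a selector
-- forwards C of them.  Inductively a level-d hub has C trees arriving only
-- after round d(H+1); one more step reaches a terminal, a leaf, after round
-- D(H+1) ≥ CD/2.

open import Data.Nat
  using (ℕ; zero; suc; _+_; _*_; _^_; _∸_; _≤_; _<_; _<?_; z≤n; s≤s; >-nonZero; ⌊_/2⌋; ⌈_/2⌉)
open import Data.Nat.Properties renaming (_≟_ to _≟ℕ_)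
open import Data.Nat.Induction using (<-rec)
open import Data.Nat.Tactic.RingSolver using (solve-∀)
open import Data.Bool using (Bool; true; false; not; T; if_then_else_; _∧_; _∨_)
open import Data.Bool.Properties using (T-≡; ∨-comm; not-involutive) renaming (_≟_ to _≟ᵇ_)
open import Data.Maybe using (Maybe; just; nothing; maybe′)
open import Data.Maybe.Properties using (just-injective)
open import Data.List using (List; []; _∷_; _++_; map; length; filterᵇ; tabulate; allFin; take)
open import Data.List.Properties using (length-map; length-++; length-take; length-tabulate; filter-++)
open import Data.List.Membership.Propositional using (_∈_)
open import Data.List.Membership.Propositional.Properties
  using (∈-filter⁻; ∈-filter⁺; ∈-allFin; ∈-map⁺; ∈-map⁻; ∈-++⁻; ∈-++⁺ˡ; ∈-++⁺ʳ)
open import Data.List.Relation.Unary.Any as Any using (here; there; _─_)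
open import Data.List.Relation.Unary.All as All using (All; _∷_)
open import Data.List.Relation.Unary.Unique.Propositional using (Unique; []; _∷_)
import Data.List.Relation.Unary.Unique.Propositional.Properties as Unique
open import Data.List.Relation.Binary.Disjoint.Propositional using (Disjoint)
open import Data.Vec using (Vec; []; _∷_)
open import Data.Fin using (Fin; zero; suc; toℕ; fromℕ<; inject≤; _≟_)
open import Data.Fin.Properties
  using (any?; toℕ-fromℕ<; toℕ-inject≤; toℕ-injective; toℕ<n; +↔⊎; *↔×; 2↔Bool; 1↔⊤)
open import Data.Product using (Σ; ∃; _×_; _,_; proj₁; proj₂)
open import Data.Product.Function.NonDependent.Propositional using (_×-↔_)
open import Data.Sum using (_⊎_; inj₁; inj₂)
open import Data.Sum.Properties using (inj₁-injective; inj₂-injective; ≡-dec)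
open import Data.Sum.Function.Propositional using (_⊎-↔_)
open import Data.Unit using (⊤; tt)
open import Data.Empty using (⊥-elim)
open import Function using (_∘_; id; _↔_; Inverse; mk↔ₛ′; mk⇔; Equivalence)
open import Function.Properties.Inverse using (↔-refl; ↔-trans)
open import Function.Related.Propositional using (module EquationalReasoning; bijection)
open import Relation.Binary.PropositionalEquality
open import Relation.Binary.Definitions using (DecidableEquality)
open import Relation.Nullary using (does; yes; no; contradiction)
open import Relation.Nullary.Decidable using (T?; ⌊_⌋; toWitness; fromWitness; does-⇔; dec-true; dec-false)
open import Defs hiding (sym)

private variable
  A B : Set

∈-─ : {x y : A} {ys : List A} (p : y ∈ ys) → x ∈ ys → x ≢ y → x ∈ (ys ─ p)
∈-─ (here refl) (here refl) x≢y = contradiction refl x≢y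
∈-─ (here refl) (there q)   _   = q
∈-─ (there p)   (here refl) _   = here refl
∈-─ (there p)   (there q)   x≢y = there (∈-─ p q x≢y)

length-─ : {y : A} {ys : List A} (p : y ∈ ys) → length ys ≡ suc (length (ys ─ p))
length-─ (here refl) = refl
length-─ (there p)   = cong suc (length-─ p)

-- The map may depend on the
-- membership proof, which is how crossing rounds are read off below.
length-≤-injection : {xs : List A} {ys : List B} → Unique xs →
  (g : ∀ {x} → x ∈ xs → B) →
  (∀ {x y} (p : x ∈ xs) (q : y ∈ xs) → g p ≡ g q → x ≡ y) →
  (∀ {x} (p : x ∈ xs) → g p ∈ ys) →
  length xs ≤ length ys
length-≤-injection {xs = []} _ _ _ _ = z≤n
length-≤-injection {xs = x ∷ xs} {ys} (x∉xs ∷ xs!) g g-inj g∈ =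
  subst (suc (length xs) ≤_) (sym (length-─ gx∈ys))
    (s≤s (length-≤-injection xs! (g ∘ there)
      (λ p q → g-inj (there p) (there q))
      (λ {y} p → ∈-─ gx∈ys (g∈ (there p)) (distinct p))))
  where
  gx∈ys = g∈ (here refl)
  distinct : ∀ {y} (p : y ∈ xs) → g (there p) ≢ g (here refl)
  distinct p eq = All.lookup x∉xs p (sym (g-inj (there p) (here refl) eq))

count-tabulate : ∀ {k} (g : Fin k → A) (f : A → Bool) →
  count (f ∘ g) ≡ length (filterᵇ f (tabulate g))
count-tabulate {k = zero}  g f = refl
count-tabulate {k = suc k} g f with f (g zero)
... | true  = cong suc (count-tabulate (g ∘ suc) f)
... | false = count-tabulate (g ∘ suc) f

count≡length-filter : ∀ {k} (f : Fin k → Bool) → count f ≡ length (filterᵇ f (allFin k))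
count≡length-filter = count-tabulate id

count-≤ : ∀ {k} (f : Fin k → Bool) (ys : List (Fin k)) →
  (∀ i → f i ≡ true → i ∈ ys) → count f ≤ length ys
count-≤ {k} f ys covers =
  subst (_≤ length ys) (sym (count≡length-filter f))
    (length-≤-injection (Unique.filter⁺ (T? ∘ f) (Unique.allFin⁺ k)) (λ {i} _ → i) (λ _ _ eq → eq)
      (λ {i} p → covers i (Equivalence.to T-≡ (proj₂ (∈-filter⁻ (T? ∘ f) {xs = allFin k} p)))))

≤-count : ∀ {k} (f : Fin k → Bool) {ys : List (Fin k)} → Unique ys →
  (∀ {i} → i ∈ ys → f i ≡ true) → length ys ≤ count f
≤-count {k} f ys! holds =
  subst (_ ≤_) (sym (count≡length-filter f))
    (length-≤-injection ys! (λ {i} _ → i) (λ _ _ eq → eq)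
      (λ {i} p → ∈-filter⁺ (T? ∘ f) (∈-allFin i) (Equivalence.from T-≡ (holds p))))

length-filterᵇ-split : (f : A → Bool) (xs : List A) →
  length (filterᵇ f xs) + length (filterᵇ (not ∘ f) xs) ≡ length xs
length-filterᵇ-split f [] = refl
length-filterᵇ-split f (x ∷ xs) with f x
... | true  = cong suc (length-filterᵇ-split f xs)
... | false = trans (+-suc _ _) (cong suc (length-filterᵇ-split f xs))

length-filterᵇ-map : (f : B → Bool) (g : A → B) (xs : List A) →
  length (filterᵇ f (map g xs)) ≡ length (filterᵇ (f ∘ g) xs)
length-filterᵇ-map f g [] = refl
length-filterᵇ-map f g (x ∷ xs) with f (g x)
... | true  = cong suc (length-filterᵇ-map f g xs)
... | false = length-filterᵇ-map f g xs

nonempty : {xs : List A} → 1 ≤ length xs → Σ A (_∈ xs)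
nonempty {xs = x ∷ _} _ = x , here refl

∈-take : ∀ n {xs : List A} {x : A} → x ∈ take n xs → x ∈ xs
∈-take (suc n) {_ ∷ _} (here refl) = here refl
∈-take (suc n) {_ ∷ _} (there p)   = there (∈-take n p)

filterᵇ-true : (xs : List A) → filterᵇ (λ _ → true) xs ≡ xs
filterᵇ-true []       = refl
filterᵇ-true (x ∷ xs) = cong (x ∷_) (filterᵇ-true xs)

pick : ∀ {m} → Vec Bool m → List A → List A
pick []       _        = []
pick (_ ∷ _)  []       = []
pick (b ∷ bs) (x ∷ xs) = if b then x ∷ pick bs xs else pick bs xs

pick-⊆ : ∀ {m} (bs : Vec Bool m) {xs : List A} {x : A} → x ∈ pick bs xs → x ∈ xs
pick-⊆ (true  ∷ bs) {_ ∷ _} (here refl) = here refl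
pick-⊆ (true  ∷ bs) {_ ∷ _} (there p)   = there (pick-⊆ bs p)
pick-⊆ (false ∷ bs) {_ ∷ _} p           = there (pick-⊆ bs p)

pick-unique : ∀ {m} (bs : Vec Bool m) {xs : List A} → Unique xs → Unique (pick bs xs)
pick-unique []           _           = []
pick-unique (_ ∷ _)      []          = []
pick-unique (true  ∷ bs) (x∉ ∷ xs!) = All-pick bs x∉ ∷ pick-unique bs xs!
  where
  All-pick : ∀ {m} (bs : Vec Bool m) {P : A → Set} {xs} → All P xs → All P (pick bs xs)
  All-pick bs {P} {xs} all = All.tabulate (λ p → All.lookup all (pick-⊆ bs p))
pick-unique (false ∷ bs) (_ ∷ xs!)  = pick-unique bs xs!

mask : ∀ m → (A → Bool) → List A → Vec Bool m
mask zero    f _        = []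
mask (suc m) f []       = false ∷ mask m f []
mask (suc m) f (x ∷ xs) = f x ∷ mask m f xs

pick-mask : ∀ m (f : A → Bool) (xs : List A) → length xs ≤ m → pick (mask m f xs) xs ≡ filterᵇ f xs
pick-mask zero    f []       _         = refl
pick-mask (suc m) f []       _         = refl
pick-mask (suc m) f (x ∷ xs) (s≤s |xs|≤m) with f x
... | true  = cong (x ∷_) (pick-mask m f xs |xs|≤m)
... | false = pick-mask m f xs |xs|≤m

child-formula-spec : ∀ {n} {mem : Bool} {v r p u : Fin n} →
  mem ∧ not ⌊ v ≟ r ⌋ ∧ ⌊ p ≟ u ⌋ ≡ true → mem ≡ true × v ≢ r × p ≡ u
child-formula-spec {mem = true} {v} {r} {p} {u} e with v ≟ r | p ≟ u
... | no v≢r | yes p≡u = refl , v≢r , p≡u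

child-formula-intro : ∀ {n} {mem : Bool} {v r p u : Fin n} →
  mem ≡ true → v ≢ r → p ≡ u → mem ∧ not ⌊ v ≟ r ⌋ ∧ ⌊ p ≟ u ⌋ ≡ true
child-formula-intro {v = v} {r} {p} {u} refl v≢r p≡u with v ≟ r | p ≟ u
... | no _    | yes _  = refl
... | yes v≡r | _      = contradiction v≡r v≢r
... | no _    | no p≢u = contradiction p≡u p≢u

ChildOf : ∀ {n} {G : Graph n} → RootedTree G → Fin n → Fin n → Set
ChildOf T v u = member T v ≡ true × v ≢ root T × parent T v ≡ u

child-spec : ∀ {n} {G : Graph n} (T : RootedTree G) {v u} → isChildOf T v u ≡ true → ChildOf T v u
child-spec T = child-formula-spec

edge-spec : ∀ {n} {G : Graph n} (T : RootedTree G) {u v} → treeEdge T u v ≡ true → ChildOf T v u ⊎ ChildOf T u v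
edge-spec T {u} {v} e with isChildOf T v u in c
... | true  = inj₁ (child-spec T c)
... | false = inj₂ (child-spec T e)

module Schedules {n} {G : Graph n} (I : Instance G) {len : ℕ} (sch : Schedule I len) where
  open Schedule sch

  Holds : ℕ → Fin (k I) → Fin n → Set
  Holds = Has send (λ j → root (tree I j))

  Late : Fin (k I) → Fin n → ℕ → Set
  Late i u t = ∀ τ → Holds τ i u → t ≤ τ

  -- Packets only move along tree edges, and a child holds a packet only after
  -- its parent has sent it; hence a non-root vertex first receives m_i from its parent.
  from-parent : ∀ τ i u → Holds τ i u →
    u ≡ root (tree I i) ⊎ ∃ λ τ' → τ' < τ × send τ' i (parent (tree I i) u) u ≡ true
  from-parent = <-rec P step
    where
    P : ℕ → Set
    P τ = ∀ i u → Holds τ i u →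
      u ≡ root (tree I i) ⊎ ∃ λ τ' → τ' < τ × send τ' i (parent (tree I i) u) u ≡ true
    step : ∀ τ → (∀ {τ'} → τ' < τ → P τ') → P τ
    step zero rec i u u≡r = inj₁ u≡r
    step (suc τ) rec i u (inj₁ held) with rec ≤-refl i u held
    ... | inj₁ u≡r = inj₁ u≡r
    ... | inj₂ (τ' , τ'<τ , e) = inj₂ (τ' , m≤n⇒m≤1+n τ'<τ , e)
    step (suc τ) rec i u (inj₂ (w , e)) with edge-spec (tree I i) (along-tree τ i w u e)
    ... | inj₁ (_ , _ , pu≡w) = inj₂ (τ , ≤-refl , subst (λ x → send τ i x u ≡ true) (sym pu≡w) e)
    ... | inj₂ (_ , w≢r , pw≡u) with rec ≤-refl i w (holds τ i w u e)
    ...   | inj₁ w≡r = contradiction w≡r w≢r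
    ...   | inj₂ (τ' , τ'<τ , e')
            with rec (m≤n⇒m≤1+n τ'<τ) i u (holds τ' i u w (subst (λ x → send τ' i x w ≡ true) pw≡u e'))
    ...     | inj₁ u≡r = inj₁ u≡r
    ...     | inj₂ (τ'' , τ''<τ' , e'') = inj₂ (τ'' , <-trans τ''<τ' (m≤n⇒m≤1+n τ'<τ) , e'')

  crossesWithin : (t H : ℕ) → Fin n → Fin (k I) → Bool
  crossesWithin t H b i = ⌊ any? (λ (δ : Fin H) → send (t + toℕ δ) i (parent (tree I i) b) b ≟ᵇ true) ⌋

  -- Capacity: one packet per edge and round, so at most H distinct packets
  -- cross a fixed edge a → b within a window of H rounds.
  few-cross : ∀ {A : Set} (t H : ℕ) (a b : Fin n) (ι : A → Fin (k I)) {xs : List A} → Unique xs →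
    (∀ {x y} → ι x ≡ ι y → x ≡ y) → (∀ {x} → x ∈ xs → parent (tree I (ι x)) b ≡ a) →
    length (filterᵇ (crossesWithin t H b ∘ ι) xs) ≤ H
  few-cross t H a b ι {xs} xs! ι-inj parent≡a =
    subst (length (filterᵇ (crossesWithin t H b ∘ ι) xs) ≤_) (length-tabulate {n = H} id)
      (length-≤-injection {ys = allFin H} (Unique.filter⁺ (T? ∘ crossesWithin t H b ∘ ι) xs!)
        (λ p → proj₁ (crossing p)) same-round (λ {x} p → ∈-allFin (proj₁ (crossing p))))
    where
    crossing : ∀ {x} → x ∈ filterᵇ (crossesWithin t H b ∘ ι) xs →
               Σ (Fin H) λ δ → send (t + toℕ δ) (ι x) a b ≡ true
    crossing {x} p with ∈-filter⁻ (T? ∘ crossesWithin t H b ∘ ι) {xs = xs} p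
    ... | x∈xs , crosses with toWitness crosses
    ...   | δ , e = δ , subst (λ y → send (t + toℕ δ) (ι x) y b ≡ true) (parent≡a (x∈xs)) e
    same-round : ∀ {x y} p q → proj₁ (crossing {x} p) ≡ proj₁ (crossing {y} q) → x ≡ y
    same-round p q eq = ι-inj (proj₁ (capacity _ _ _ a b a b (proj₂ (crossing p))
      (subst (λ δ → send (t + toℕ δ) _ a b ≡ true) (sym eq) (proj₂ (crossing q))) (inj₁ (refl , refl))))

  many-late : ∀ {A : Set} (C t H : ℕ) (a b : Fin n) (ι : A → Fin (k I)) {xs : List A} → Unique xs →
    (∀ {x y} → ι x ≡ ι y → x ≡ y) → (∀ {x} → x ∈ xs → parent (tree I (ι x)) b ≡ a) →
    length xs ≡ C → C ≤ length (filterᵇ (not ∘ crossesWithin t H b ∘ ι) xs) + H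
  many-late C t H a b ι {xs} xs! ι-inj parent≡a |xs|≡C = begin
    C                           ≡⟨ sym |xs|≡C ⟩
    length xs                   ≡⟨ sym (length-filterᵇ-split (crossesWithin t H b ∘ ι) xs) ⟩
    length (filterᵇ crossing xs) + length (filterᵇ (not ∘ crossing) xs)
                                ≤⟨ +-monoˡ-≤ _ (few-cross t H a b ι xs! ι-inj parent≡a) ⟩
    H + length (filterᵇ (not ∘ crossing) xs)
                                ≡⟨ +-comm H _ ⟩
    length (filterᵇ (not ∘ crossing) xs) + H ∎
    where
    open ≤-Reasoning
    crossing = crossesWithin t H b ∘ ι

  late-arrival : ∀ (t H : ℕ) i {a b} → ChildOf (tree I i) b a → Late i a t →
    crossesWithin t H b i ≡ false → Late i b (suc H + t)
  late-arrival t H i {a} {b} (_ , b≢r , p≡a) a-late no-cross τ held with from-parent τ i b held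
  ... | inj₁ b≡r = contradiction b≡r b≢r
  ... | inj₂ (τ' , τ'<τ , e) with τ' <? t + H
  ...   | yes τ'<t+H = ⊥-elim (subst T no-cross (fromWitness (δ , e')))
    where
    t≤τ' : t ≤ τ'
    t≤τ' = a-late τ' (holds τ' i a b (subst (λ x → send τ' i x b ≡ true) p≡a e))
    δ : Fin H
    δ = fromℕ< (subst (τ' ∸ t <_) (m+n∸m≡n t H) (∸-monoˡ-< τ'<t+H t≤τ'))
    e' : send (t + toℕ δ) i (parent (tree I i) b) b ≡ true
    e' = subst (λ r → send r i (parent (tree I i) b) b ≡ true)
           (sym (trans (cong (t +_) (toℕ-fromℕ< _)) (m+[n∸m]≡n t≤τ'))) e
  ...   | no τ'≮t+H = subst (_≤ τ) (cong suc (+-comm t H)) (≤-trans (s≤s (≮⇒≥ τ'≮t+H)) τ'<τ)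

module Embedding {V : Set} {m n : ℕ} (V↔ : Fin m ↔ V) (m≤n : m ≤ n) where
  open Inverse V↔ using (to; from; strictlyInverseˡ; strictlyInverseʳ)

  enc : V → Fin n
  enc v = inject≤ (from v) m≤n

  dec : Fin n → Maybe V
  dec u with toℕ u <? m
  ... | yes u<m = just (to (fromℕ< u<m))
  ... | no _    = nothing

  dec-enc : ∀ v → dec (enc v) ≡ just v
  dec-enc v with toℕ (enc v) <? m
  ... | yes p = cong just (trans (cong to (toℕ-injective (trans (toℕ-fromℕ< p) (toℕ-inject≤ (from v) m≤n))))
                                 (strictlyInverseˡ v))
  ... | no ¬p = contradiction (subst (_< m) (sym (toℕ-inject≤ (from v) m≤n)) (toℕ<n (from v))) ¬p

  enc-dec : ∀ {u v} → dec u ≡ just v → enc v ≡ u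
  enc-dec {u} e with toℕ u <? m
  enc-dec {u} refl | yes p = toℕ-injective (begin
    toℕ (inject≤ (from (to (fromℕ< p))) m≤n) ≡⟨ toℕ-inject≤ _ m≤n ⟩
    toℕ (from (to (fromℕ< p)))              ≡⟨ cong toℕ (strictlyInverseʳ (fromℕ< p)) ⟩
    toℕ (fromℕ< p)                          ≡⟨ toℕ-fromℕ< p ⟩
    toℕ u ∎)
    where open ≡-Reasoning

  enc-injective : ∀ {v w} → enc v ≡ enc w → v ≡ w
  enc-injective {v} {w} e = just-injective (trans (sym (dec-enc v)) (trans (cong dec e) (dec-enc w)))

-- A family of rooted trees on an arbitrary vertex type V, indexed by Tr,
-- given by parent pointers and one level function common to all trees.
record Forest (V Tr : Set) : Set where
  field
    root          : Tr → V
    member        : Tr → V → Bool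
    parent        : Tr → V → V
    level         : V → ℕ
    root-member   : ∀ t → member t (root t) ≡ true
    root-level    : ∀ t → level (root t) ≡ 0
    parent-member : ∀ t v → member t v ≡ true → v ≢ root t → member t (parent t v) ≡ true
    parent-level  : ∀ t v → member t v ≡ true → v ≢ root t → level v ≡ suc (level (parent t v))

ChildIn : ∀ {V Tr} → Forest V Tr → Tr → V → V → Set
ChildIn F t v w = Forest.member F t v ≡ true × v ≢ Forest.root F t × Forest.parent F t v ≡ w

-- A forest with m vertices and k trees yields a multicast instance on the
-- n-node graph whose edges are exactly the tree edges.
module UnionGraph {V Tr : Set} {k m n : ℕ} (F : Forest V Tr)
                  (V↔ : Fin m ↔ V) (m≤n : m ≤ n) (Tr↔ : Fin k ↔ Tr) where
  open Embedding V↔ m≤n public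
  private
    module F = Forest F
    module Tr = Inverse Tr↔

  member′ : Tr → Fin n → Bool
  member′ t u = maybe′ (F.member t) false (dec u)

  parent′ : Tr → Fin n → Fin n
  parent′ t u = maybe′ (enc ∘ F.parent t) u (dec u)

  level′ : Fin n → ℕ
  level′ u = maybe′ F.level 0 (dec u)

  -- the tree edges of T_t, with the same formulas as 'isChildOf' and 'treeEdge'
  child′ : Tr → Fin n → Fin n → Bool
  child′ t v u = member′ t v ∧ not ⌊ v ≟ enc (F.root t) ⌋ ∧ ⌊ parent′ t v ≟ u ⌋

  edge′ : Tr → Fin n → Fin n → Bool
  edge′ t u v = child′ t v u ∨ child′ t u v

  member′-enc : ∀ t y → member′ t (enc y) ≡ F.member t y
  member′-enc t y rewrite dec-enc y = refl

  parent′-enc : ∀ t y → parent′ t (enc y) ≡ enc (F.parent t y)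
  parent′-enc t y rewrite dec-enc y = refl

  level′-enc : ∀ y → level′ (enc y) ≡ F.level y
  level′-enc y rewrite dec-enc y = refl

  level′-≤ : ∀ {D} → (∀ y → F.level y ≤ D) → ∀ u → level′ u ≤ D
  level′-≤ bound u with dec u
  ... | just y  = bound y
  ... | nothing = z≤n

  decode : ∀ t v → member′ t v ≡ true → v ≢ enc (F.root t) →
           Σ V λ y → v ≡ enc y × ChildIn F t y (F.parent t y)
  decode t v mem v≢r with dec v in eq
  ... | just y with refl ← enc-dec eq = y , refl , mem , (λ y≡r → v≢r (cong enc y≡r)) , refl

  child′-enc : ∀ {t y w} → ChildIn F t y w → child′ t (enc y) (enc w) ≡ true
  child′-enc {t} {y} {w} (mem , y≢r , p≡w) =
    child-formula-intro (trans (member′-enc t y) mem) (λ e → y≢r (enc-injective e))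
                        (trans (parent′-enc t y) (cong enc p≡w))

  parent′-member : ∀ t v → member′ t v ≡ true → v ≢ enc (F.root t) → member′ t (parent′ t v) ≡ true
  parent′-member t v mem v≢r with decode t v mem v≢r
  ... | y , refl , mem-y , y≢r , _ = begin
    member′ t (parent′ t (enc y))   ≡⟨ cong (member′ t) (parent′-enc t y) ⟩
    member′ t (enc (F.parent t y))  ≡⟨ member′-enc t (F.parent t y) ⟩
    F.member t (F.parent t y)       ≡⟨ F.parent-member t y mem-y y≢r ⟩
    true ∎
    where open ≡-Reasoning

  parent′-level : ∀ t v → member′ t v ≡ true → v ≢ enc (F.root t) → level′ v ≡ suc (level′ (parent′ t v))
  parent′-level t v mem v≢r with decode t v mem v≢r
  ... | y , refl , mem-y , y≢r , _ = begin
    level′ (enc y)                     ≡⟨ level′-enc y ⟩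
    F.level y                          ≡⟨ F.parent-level t y mem-y y≢r ⟩
    suc (F.level (F.parent t y))       ≡⟨ cong suc (sym (level′-enc (F.parent t y))) ⟩
    suc (level′ (enc (F.parent t y)))  ≡⟨ cong (suc ∘ level′) (sym (parent′-enc t y)) ⟩
    suc (level′ (parent′ t (enc y))) ∎
    where open ≡-Reasoning

  adjacent : Fin n → Fin n → Bool
  adjacent u v = does (any? λ i → T? (edge′ (Tr.to i) u v))

  adjacent-intro : ∀ t {u v} → edge′ t u v ≡ true → adjacent u v ≡ true
  adjacent-intro t {u} {v} e =
    dec-true (any? _) (Tr.from t , subst (λ t′ → T (edge′ t′ u v)) (sym (Tr.strictlyInverseˡ t))
                                          (Equivalence.from T-≡ e))

  -- a tree edge joins two consecutive levels, so there are no loops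
  no-loop : ∀ t u → edge′ t u u ≢ true
  no-loop t u e with child′ t u u in c
  ... | true = let (mem , u≢r , p≡u) = child-formula-spec c in
                1+n≢n (sym (trans (parent′-level t u mem u≢r) (cong (suc ∘ level′) p≡u)))
  no-loop t u () | false

  graph : Graph n
  graph = record
    { adj    = adjacent
    ; sym    = λ u v → does-⇔ (mk⇔ flip flip) (any? _) (any? _)
    ; irrefl = λ u → dec-false (any? _) λ (i , p) → no-loop (Tr.to i) u (Equivalence.to T-≡ p) }
    where
    flip : ∀ {u v} → ∃ (λ i → T (edge′ (Tr.to i) u v)) → ∃ (λ i → T (edge′ (Tr.to i) v u))
    flip {u} {v} (i , p) = i , subst T (∨-comm (child′ (Tr.to i) v u) (child′ (Tr.to i) u v)) p

  treeAt : Tr → RootedTree graph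
  treeAt t = record
    { root          = enc (F.root t)
    ; member        = member′ t
    ; parent        = parent′ t
    ; level         = level′
    ; root-member   = trans (member′-enc t (F.root t)) (F.root-member t)
    ; root-level    = trans (level′-enc (F.root t)) (F.root-level t)
    ; parent-member = parent′-member t
    ; parent-adj    = λ v mem v≢r → adjacent-intro t
                        (cong (_∨ child′ t (parent′ t v) v) (child-formula-intro mem v≢r refl))
    ; parent-level  = parent′-level t }

  multicast : Instance graph
  multicast = record { k = k ; tree = treeAt ∘ Tr.to }

  index : Tr → Fin k
  index = Tr.from

  index-injective : ∀ {t t'} → index t ≡ index t' → t ≡ t'
  index-injective {t} {t'} e =
    trans (sym (Tr.strictlyInverseˡ t)) (trans (cong Tr.to e) (Tr.strictlyInverseˡ t'))

  tree-index : ∀ t → tree multicast (index t) ≡ treeAt t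
  tree-index t = cong treeAt (Tr.strictlyInverseˡ t)

  member-index : ∀ t y → member (tree multicast (index t)) (enc y) ≡ F.member t y
  member-index t y = trans (cong (λ T → member T (enc y)) (tree-index t)) (member′-enc t y)

  childOf-index : ∀ {t y w} → ChildIn F t y w → ChildOf (tree multicast (index t)) (enc y) (enc w)
  childOf-index {t} {y} {w} c =
    subst (λ T → ChildOf T (enc y) (enc w)) (sym (tree-index t)) (child-formula-spec (child′-enc c))

  child-decode : ∀ t {v u} → ChildOf (treeAt t) v u →
                 Σ V λ y → v ≡ enc y × u ≡ enc (F.parent t y) × ChildIn F t y (F.parent t y)
  child-decode t {v} (mem , v≢r , p≡u) with decode t v mem v≢r
  ... | y , refl , c = y , refl , trans (sym p≡u) (parent′-enc t y) , c

  child-level : ∀ t {v u} → ChildOf (treeAt t) v u → level′ v ≡ suc (level′ u)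
  child-level t {v} (mem , v≢r , p≡u) = trans (parent′-level t v mem v≢r) (cong (suc ∘ level′) p≡u)

  module _ (C : ℕ) (via : V → V → List Tr)
           (via-complete : ∀ t y → F.member t y ≡ true → y ≢ F.root t → t ∈ via y (F.parent t y))
           (via-short : ∀ y w → length (via y w) ≤ C) where

    via′ : Fin n → Fin n → List (Fin k)
    via′ v u = maybe′ (λ y → maybe′ (λ w → map Tr.from (via y w)) [] (dec u)) [] (dec v)

    via′-short : ∀ v u → length (via′ v u) ≤ C
    via′-short v u with dec v | dec u
    ... | just y  | just w  = subst (_≤ C) (sym (length-map Tr.from (via y w))) (via-short y w)
    ... | just _  | nothing = z≤n
    ... | nothing | _       = z≤n

    listed : ∀ i {v u} → ChildOf (treeAt (Tr.to i)) v u → i ∈ via′ v u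
    listed i c with child-decode (Tr.to i) c
    ... | y , refl , refl , mem , y≢r , _ rewrite dec-enc y | dec-enc (F.parent (Tr.to i) y) =
      subst (_∈ map Tr.from (via y (F.parent (Tr.to i) y))) (Tr.strictlyInverseʳ i)
        (∈-map⁺ Tr.from (via-complete (Tr.to i) y mem y≢r))

    -- all trees through {u , v} enter the lower endpoint from the upper one
    load-≤ : ∀ u v → load multicast u v ≤ C
    load-≤ u v with suc (level′ u) ≟ℕ level′ v
    ... | yes down = ≤-trans (count-≤ _ (via′ v u) downward) (via′-short v u)
      where
      downward : ∀ i → treeEdge (treeAt (Tr.to i)) u v ≡ true → i ∈ via′ v u
      downward i e with edge-spec (treeAt (Tr.to i)) e
      ... | inj₁ v↓u = listed i v↓u
      ... | inj₂ u↓v = contradiction (trans (sym down) (cong suc (child-level _ u↓v))) (m≢1+n+m _ {1})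
    ... | no ¬down = ≤-trans (count-≤ _ (via′ u v) upward) (via′-short u v)
      where
      upward : ∀ i → treeEdge (treeAt (Tr.to i)) u v ≡ true → i ∈ via′ u v
      upward i e with edge-spec (treeAt (Tr.to i)) e
      ... | inj₁ v↓u = contradiction (sym (child-level _ v↓u)) ¬down
      ... | inj₂ u↓v = listed i u↓v

  load-≥ : ∀ {y w} (ts : List Tr) → Unique ts → (∀ {t} → t ∈ ts → ChildIn F t y w) →
    length ts ≤ load multicast (enc w) (enc y)
  load-≥ {y} {w} ts ts! through =
    subst (_≤ _) (length-map index ts) (≤-count _ (Unique.map⁺ index-injective ts!) uses)
    where
    uses : ∀ {i} → i ∈ map index ts → treeEdge (treeAt (Tr.to i)) (enc w) (enc y) ≡ true
    uses p with ∈-map⁻ index p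
    ... | t , t∈ts , refl rewrite Tr.strictlyInverseˡ t | child′-enc (through t∈ts) = refl

  adjacent-enc : ∀ {t y w} → ChildIn F t y w → adjacent (enc w) (enc y) ≡ true
  adjacent-enc {t} {y} {w} c = adjacent-intro t (cong (_∨ child′ t (enc w) (enc y)) (child′-enc c))

-- A gadget of level d carries
-- the C·2^d trees 'Tree d'; the gadget of level d + 1 consists of two copies
-- of the level-d gadget and one hub for every way of forwarding C of the
-- trees arriving at a level-d hub of each copy.
module Gadget (C : ℕ) where

  Tree : ℕ → Set
  Tree zero    = Fin C
  Tree (suc d) = Tree d ⊎ Tree d

  _≟ᵗ_ : ∀ {d} → DecidableEquality (Tree d)
  _≟ᵗ_ {zero}  = _≟_
  _≟ᵗ_ {suc d} = ≡-dec _≟ᵗ_ _≟ᵗ_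

  _∈ᵇ_ : ∀ {d} → Tree d → List (Tree d) → Bool
  t ∈ᵇ ts = does (Any.any? (t ≟ᵗ_) ts)

  ∈ᵇ-sound : ∀ {d} {t : Tree d} {ts} → t ∈ᵇ ts ≡ true → t ∈ ts
  ∈ᵇ-sound {t = t} {ts} e with Any.any? (t ≟ᵗ_) ts
  ... | yes p = p

  ∈ᵇ-complete : ∀ {d} {t : Tree d} {ts} → t ∈ ts → t ∈ᵇ ts ≡ true
  ∈ᵇ-complete {t = t} {ts} = dec-true (Any.any? (t ≟ᵗ_) ts)

  -- a selector marks which of the (at most 2C) trees entering a hub move on
  Sel : Set
  Sel = Vec Bool (C + C)

  data Hub : ℕ → Set where
    base : Hub 0
    comb : ∀ {d} → Hub d → Sel → Hub d → Sel → Hub (suc d)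

  mutual
    In : ∀ {d} → Hub d → List (Tree d)
    In base                 = allFin C
    In (comb h₁ s₁ h₂ s₂) = map inj₁ (out h₁ s₁) ++ map inj₂ (out h₂ s₂)

    out : ∀ {d} → Hub d → Sel → List (Tree d)
    out h s = take C (pick s (In h))

  out-⊆ : ∀ {d} (h : Hub d) s {t} → t ∈ out h s → t ∈ In h
  out-⊆ h s = pick-⊆ s ∘ ∈-take C

  out-length : ∀ {d} (h : Hub d) s → length (out h s) ≤ C
  out-length h s = subst (_≤ C) (sym (length-take C _)) (m⊓n≤m C _)

  In-length : ∀ {d} (h : Hub d) → length (In h) ≤ C + C
  In-length base = subst (_≤ C + C) (sym (length-tabulate id)) (m≤m+n C C)
  In-length (comb h₁ s₁ h₂ s₂) = begin
    length (map inj₁ (out h₁ s₁) ++ map inj₂ (out h₂ s₂))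
      ≡⟨ length-++ (map inj₁ (out h₁ s₁)) ⟩
    length (map inj₁ (out h₁ s₁)) + length (map inj₂ (out h₂ s₂))
      ≡⟨ cong₂ _+_ (length-map inj₁ (out h₁ s₁)) (length-map inj₂ (out h₂ s₂)) ⟩
    length (out h₁ s₁) + length (out h₂ s₂)
      ≤⟨ +-mono-≤ (out-length h₁ s₁) (out-length h₂ s₂) ⟩
    C + C ∎
    where open ≤-Reasoning

  mutual
    In-unique : ∀ {d} (h : Hub d) → Unique (In h)
    In-unique base = Unique.allFin⁺ C
    In-unique (comb h₁ s₁ h₂ s₂) =
      Unique.++⁺ (Unique.map⁺ inj₁-injective (out-unique h₁ s₁))
                 (Unique.map⁺ inj₂-injective (out-unique h₂ s₂)) sides-disjoint
      where
      sides-disjoint : Disjoint (map inj₁ (out h₁ s₁)) (map inj₂ (out h₂ s₂))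
      sides-disjoint (p , q) with ∈-map⁻ inj₁ p | ∈-map⁻ inj₂ q
      ... | _ , _ , refl | _ , _ , ()

    out-unique : ∀ {d} (h : Hub d) s → Unique (out h s)
    out-unique h s = Unique.take⁺ C (pick-unique s (In-unique h))

  In-inj₁ : ∀ {d} {h₁ h₂ : Hub d} {s₁ s₂} {t} → inj₁ t ∈ In (comb h₁ s₁ h₂ s₂) → t ∈ out h₁ s₁
  In-inj₁ {h₁ = h₁} {s₁ = s₁} p with ∈-++⁻ (map inj₁ (out h₁ s₁)) p
  ... | inj₁ q = let _ , t∈ , e = ∈-map⁻ inj₁ q in subst (_∈ _) (sym (inj₁-injective e)) t∈
  ... | inj₂ q with ∈-map⁻ inj₂ q
  ...   | _ , _ , ()

  In-inj₂ : ∀ {d} {h₁ h₂ : Hub d} {s₁ s₂} {t} → inj₂ t ∈ In (comb h₁ s₁ h₂ s₂) → t ∈ out h₂ s₂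
  In-inj₂ {h₁ = h₁} {s₁ = s₁} p with ∈-++⁻ (map inj₁ (out h₁ s₁)) p
  ... | inj₂ q = let _ , t∈ , e = ∈-map⁻ inj₂ q in subst (_∈ _) (sym (inj₂-injective e)) t∈
  ... | inj₁ q with ∈-map⁻ inj₁ q
  ...   | _ , _ , ()

  select : ∀ {d} (h : Hub d) (f : Tree d → Bool) → C ≤ length (filterᵇ f (In h)) →
           Σ Sel λ s → length (out h s) ≡ C × (∀ {t} → t ∈ out h s → t ∈ In h × f t ≡ true)
  select h f enough = s , length-C , selected
    where
    s = mask (C + C) f (In h)
    picked : pick s (In h) ≡ filterᵇ f (In h)
    picked = pick-mask (C + C) f (In h) (In-length h)
    length-C : length (out h s) ≡ C
    length-C = trans (length-take C _) (m≤n⇒m⊓n≡m (subst (C ≤_) (cong length (sym picked)) enough))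
    selected : ∀ {t} → t ∈ out h s → t ∈ In h × f t ≡ true
    selected p with ∈-filter⁻ (T? ∘ f) {xs = In h} (subst (_ ∈_) picked (∈-take C p))
    ... | t∈ , ft = t∈ , Equivalence.to T-≡ ft

  -- the vertices of the level-d gadget: its hubs and the two copies below
  data Node : ℕ → Set where
    hub : ∀ {d} → Hub d → Node d
    L R : ∀ {d} → Node d → Node (suc d)

  -- Tree t of level d + 1 is tree t' of the left (t = inj₁ t') or right copy,
  -- extended through the level-(d+1) hubs that select it.
  rootN : ∀ {d} → Tree d → Node d
  rootN {zero}  _        = hub base
  rootN {suc d} (inj₁ t) = L (rootN t)
  rootN {suc d} (inj₂ t) = R (rootN t)

  memberN : ∀ {d} → Tree d → Node d → Bool
  memberN t        (hub h) = t ∈ᵇ In h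
  memberN (inj₁ t) (L x)   = memberN t x
  memberN (inj₂ _) (L _)   = false
  memberN (inj₁ _) (R _)   = false
  memberN (inj₂ t) (R x)   = memberN t x

  parentN : ∀ {d} → Tree d → Node d → Node d
  parentN _        (hub base)             = hub base
  parentN (inj₁ _) (hub (comb h₁ _ _ _)) = L (hub h₁)
  parentN (inj₂ _) (hub (comb _ _ h₂ _)) = R (hub h₂)
  parentN (inj₁ t) (L x)                  = L (parentN t x)
  parentN (inj₂ _) (L x)                  = L x
  parentN (inj₁ _) (R x)                  = R x
  parentN (inj₂ t) (R x)                  = R (parentN t x)

  levelN : ∀ {d} → Node d → ℕ
  levelN (hub {d} _) = d
  levelN (L x)       = levelN x
  levelN (R x)       = levelN x

  viaN : ∀ {d} → Node d → Node d → List (Tree d)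
  viaN (hub (comb h₁ s₁ _ _)) (L _) = map inj₁ (out h₁ s₁)
  viaN (hub (comb _ _ h₂ s₂)) (R _) = map inj₂ (out h₂ s₂)
  viaN (L x)                  (L w) = map inj₁ (viaN x w)
  viaN (R x)                  (R w) = map inj₂ (viaN x w)
  viaN _                      _     = []

  memberN-root : ∀ {d} (t : Tree d) → memberN t (rootN t) ≡ true
  memberN-root {zero}  t        = ∈ᵇ-complete (∈-allFin t)
  memberN-root {suc d} (inj₁ t) = memberN-root t
  memberN-root {suc d} (inj₂ t) = memberN-root t

  levelN-root : ∀ {d} (t : Tree d) → levelN (rootN t) ≡ 0
  levelN-root {zero}  t        = refl
  levelN-root {suc d} (inj₁ t) = levelN-root t
  levelN-root {suc d} (inj₂ t) = levelN-root t

  levelN-≤ : ∀ {d} (x : Node d) → levelN x ≤ d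
  levelN-≤ (hub h) = ≤-refl
  levelN-≤ (L x)   = m≤n⇒m≤1+n (levelN-≤ x)
  levelN-≤ (R x)   = m≤n⇒m≤1+n (levelN-≤ x)

  viaN-length : ∀ {d} (x w : Node d) → length (viaN x w) ≤ C
  viaN-length (hub (comb h₁ s₁ _ _)) (L _) = subst (_≤ C) (sym (length-map inj₁ (out h₁ s₁))) (out-length h₁ s₁)
  viaN-length (hub (comb _ _ h₂ s₂)) (R _) = subst (_≤ C) (sym (length-map inj₂ (out h₂ s₂))) (out-length h₂ s₂)
  viaN-length (hub (comb _ _ _ _))   (hub _) = z≤n
  viaN-length (hub base)             _     = z≤n
  viaN-length (L x)                  (L w) = subst (_≤ C) (sym (length-map inj₁ (viaN x w))) (viaN-length x w)
  viaN-length (L x)                  (R w) = z≤n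
  viaN-length (L x)                  (hub _) = z≤n
  viaN-length (R x)                  (R w) = subst (_≤ C) (sym (length-map inj₂ (viaN x w))) (viaN-length x w)
  viaN-length (R x)                  (L w) = z≤n
  viaN-length (R x)                  (hub _) = z≤n

  parentN-spec : ∀ {d} (t : Tree d) x → memberN t x ≡ true → x ≢ rootN t →
    memberN t (parentN t x) ≡ true × levelN x ≡ suc (levelN (parentN t x)) × t ∈ viaN x (parentN t x)
  parentN-spec t (hub base) _ x≢r = contradiction refl x≢r
  parentN-spec (inj₁ t) (hub (comb h₁ s₁ h₂ s₂)) mem _ =
    let t∈ = In-inj₁ {h₁ = h₁} {h₂} {s₁} {s₂} (∈ᵇ-sound mem)
    in ∈ᵇ-complete (out-⊆ h₁ s₁ t∈) , refl , ∈-map⁺ inj₁ t∈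
  parentN-spec (inj₂ t) (hub (comb h₁ s₁ h₂ s₂)) mem _ =
    let t∈ = In-inj₂ {h₁ = h₁} {h₂} {s₁} {s₂} (∈ᵇ-sound mem)
    in ∈ᵇ-complete (out-⊆ h₂ s₂ t∈) , refl , ∈-map⁺ inj₂ t∈
  parentN-spec (inj₁ t) (L x) mem x≢r =
    let m , l , v = parentN-spec t x mem (x≢r ∘ cong L) in m , l , ∈-map⁺ inj₁ v
  parentN-spec (inj₂ t) (R x) mem x≢r =
    let m , l , v = parentN-spec t x mem (x≢r ∘ cong R) in m , l , ∈-map⁺ inj₂ v

  -- The network of depth E + 1: the level-E gadget together with a terminal
  -- vertex for every hub h of level E and selector s, receiving out h s.
  data Vertex (E : ℕ) : Set where
    node     : Node E → Vertex E
    terminal : Hub E → Sel → Vertex E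

  forest : ∀ E → Forest (Vertex E) (Tree E)
  forest E = record
    { root          = node ∘ rootN
    ; member        = memberV
    ; parent        = parentV
    ; level         = levelV
    ; root-member   = memberN-root
    ; root-level    = levelN-root
    ; parent-member = memberV-parent
    ; parent-level  = levelV-parent }
    where
    memberV : Tree E → Vertex E → Bool
    memberV t (node x)       = memberN t x
    memberV t (terminal h s) = t ∈ᵇ out h s
    parentV : Tree E → Vertex E → Vertex E
    parentV t (node x)       = node (parentN t x)
    parentV t (terminal h s) = node (hub h)
    levelV : Vertex E → ℕ
    levelV (node x)       = levelN x
    levelV (terminal h s) = suc E
    memberV-parent : ∀ t v → memberV t v ≡ true → v ≢ node (rootN t) → memberV t (parentV t v) ≡ true
    memberV-parent t (node x)       mem v≢r = proj₁ (parentN-spec t x mem (v≢r ∘ cong node))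
    memberV-parent t (terminal h s) mem _   = ∈ᵇ-complete (out-⊆ h s (∈ᵇ-sound mem))
    levelV-parent : ∀ t v → memberV t v ≡ true → v ≢ node (rootN t) → levelV v ≡ suc (levelV (parentV t v))
    levelV-parent t (node x)       mem v≢r = proj₁ (proj₂ (parentN-spec t x mem (v≢r ∘ cong node)))
    levelV-parent t (terminal h s) _   _   = refl

  via : ∀ {E} → Vertex E → Vertex E → List (Tree E)
  via (node x)       (node w) = viaN x w
  via (terminal h s) _        = out h s
  via (node _)       (terminal _ _) = []

  module _ {E : ℕ} where
    private
      module F = Forest (forest E)

    via-complete : ∀ t v → F.member t v ≡ true → v ≢ F.root t → t ∈ via v (F.parent t v)
    via-complete t (node x)       mem v≢r = proj₂ (proj₂ (parentN-spec t x mem (v≢r ∘ cong node)))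
    via-complete t (terminal h s) mem _   = ∈ᵇ-sound mem

    via-length : ∀ (v w : Vertex E) → length (via v w) ≤ C
    via-length (node x)       (node w)       = viaN-length x w
    via-length (terminal h s) _              = out-length h s
    via-length (node _)       (terminal _ _) = z≤n

    level-≤ : ∀ v → F.level v ≤ suc E
    level-≤ (node x)       = m≤n⇒m≤1+n (levelN-≤ x)
    level-≤ (terminal _ _) = ≤-refl

  select-all : ∀ {d} (h : Hub d) → C ≤ length (In h) → Σ Sel λ s → length (out h s) ≡ C
  select-all h enough with select h (λ _ → true) (subst (C ≤_) (cong length (sym (filterᵇ-true (In h)))) enough)
  ... | s , length-C , _ = s , length-C

  saturated : ∀ d → Σ (Hub d) λ h → Σ Sel λ s → length (out h s) ≡ C
  saturated zero = base , select-all base (≤-reflexive (sym (length-tabulate id)))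
  saturated (suc d) with saturated d
  ... | h , s , length-C = y , select-all y (begin
    C                                                  ≤⟨ m≤m+n C C ⟩
    C + C                                              ≡⟨ cong₂ _+_ (sym length-C) (sym length-C) ⟩
    length (out h s) + length (out h s)
      ≡⟨ cong₂ _+_ (length-map inj₁ (out h s)) (length-map inj₂ (out h s)) ⟨
    length (map inj₁ (out h s)) + length (map inj₂ (out h s)) ≡⟨ length-++ (map inj₁ (out h s)) ⟨
    length (In y) ∎)
    where
    open ≤-Reasoning
    y = comb h s h s

  -- a copy of the level-d gadget inside the level-E gadget, and the
  -- corresponding embeddings of its vertices and trees
  data Pos (E : ℕ) : ℕ → Set where
    top     : Pos E E
    inL inR : ∀ {d} → Pos E (suc d) → Pos E d

  embN : ∀ {E d} → Pos E d → Node d → Node E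
  embN top     x = x
  embN (inL p) x = embN p (L x)
  embN (inR p) x = embN p (R x)

  embT : ∀ {E d} → Pos E d → Tree d → Tree E
  embT top     t = t
  embT (inL p) t = embT p (inj₁ t)
  embT (inR p) t = embT p (inj₂ t)

  embT-injective : ∀ {E d} (p : Pos E d) {t t'} → embT p t ≡ embT p t' → t ≡ t'
  embT-injective top     e = e
  embT-injective (inL p) e = inj₁-injective (embT-injective p e)
  embT-injective (inR p) e = inj₂-injective (embT-injective p e)

  embed-member : ∀ {E d} (p : Pos E d) t x → memberN (embT p t) (embN p x) ≡ memberN t x
  embed-member top     t x = refl
  embed-member (inL p) t x = embed-member p (inj₁ t) (L x)
  embed-member (inR p) t x = embed-member p (inj₂ t) (R x)

  embed-parent : ∀ {E d} (p : Pos E d) t x → parentN (embT p t) (embN p x) ≡ embN p (parentN t x)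
  embed-parent top     t x = refl
  embed-parent (inL p) t x = embed-parent p (inj₁ t) (L x)
  embed-parent (inR p) t x = embed-parent p (inj₂ t) (R x)

  embed-level : ∀ {E d} (p : Pos E d) x → levelN (embN p x) ≡ levelN x
  embed-level top     x = refl
  embed-level (inL p) x = embed-level p (L x)
  embed-level (inR p) x = embed-level p (R x)

module _ where
  open EquationalReasoning {k = bijection}

  vec↔ : ∀ {A : Set} {m} → Vec A (suc m) ↔ (A × Vec A m)
  vec↔ = mk↔ₛ′ (λ { (x ∷ xs) → x , xs }) (λ (x , xs) → x ∷ xs) (λ _ → refl) (λ { (_ ∷ _) → refl })

  bits↔ : ∀ m → Fin (2 ^ m) ↔ Vec Bool m
  bits↔ zero = begin
    Fin 1       ↔⟨ 1↔⊤ ⟩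
    ⊤           ↔⟨ mk↔ₛ′ (λ _ → []) (λ _ → tt) (λ { [] → refl }) (λ _ → refl) ⟩
    Vec Bool 0  ∎
  bits↔ (suc m) = begin
    Fin (2 * 2 ^ m)      ↔⟨ *↔× ⟩
    (Fin 2 × Fin (2 ^ m)) ↔⟨ 2↔Bool ×-↔ bits↔ m ⟩
    (Bool × Vec Bool m)  ↔⟨ vec↔ ⟨
    Vec Bool (suc m)     ∎

module Counts (C : ℕ) where
  open Gadget C

  S : ℕ
  S = 2 ^ (C + C)

  width : ℕ → ℕ
  width zero    = C
  width (suc d) = width d + width d

  hubs : ℕ → ℕ
  hubs zero    = 1
  hubs (suc d) = (hubs d * S) * (hubs d * S)

  nodes : ℕ → ℕ
  nodes zero    = hubs zero
  nodes (suc d) = hubs (suc d) + (nodes d + nodes d)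

  vertices : ℕ → ℕ
  vertices E = nodes E + hubs E * S

  module _ where
    open EquationalReasoning {k = bijection}

    tree↔ : ∀ d → Fin (width d) ↔ Tree d
    tree↔ zero    = ↔-refl
    tree↔ (suc d) = ↔-trans +↔⊎ (tree↔ d ⊎-↔ tree↔ d)

    hub↔ : ∀ d → Fin (hubs d) ↔ Hub d
    hub↔ zero = begin
      Fin 1  ↔⟨ 1↔⊤ ⟩
      ⊤      ↔⟨ mk↔ₛ′ (λ _ → base) (λ _ → tt) (λ { base → refl }) (λ _ → refl) ⟩
      Hub 0  ∎
    hub↔ (suc d) = begin
      Fin ((hubs d * S) * (hubs d * S))                ↔⟨ *↔× ⟩
      (Fin (hubs d * S) × Fin (hubs d * S))            ↔⟨ *↔× ×-↔ *↔× ⟩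
      ((Fin (hubs d) × Fin S) × (Fin (hubs d) × Fin S)) ↔⟨ hub-sel ×-↔ hub-sel ⟩
      ((Hub d × Sel) × (Hub d × Sel))
        ↔⟨ mk↔ₛ′ to from (λ _ → refl) (λ { (comb _ _ _ _) → refl }) ⟨
      Hub (suc d)                                      ∎
      where
      hub-sel = hub↔ d ×-↔ bits↔ (C + C)
      to : Hub (suc d) → (Hub d × Sel) × (Hub d × Sel)
      to (comb h₁ s₁ h₂ s₂) = (h₁ , s₁) , (h₂ , s₂)
      from : (Hub d × Sel) × (Hub d × Sel) → Hub (suc d)
      from ((h₁ , s₁) , (h₂ , s₂)) = comb h₁ s₁ h₂ s₂

    node↔ : ∀ d → Fin (nodes d) ↔ Node d
    node↔ zero = ↔-trans (hub↔ zero) (mk↔ₛ′ hub (λ { (hub h) → h }) (λ { (hub _) → refl }) (λ _ → refl))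
    node↔ (suc d) = begin
      Fin (hubs (suc d) + (nodes d + nodes d))  ↔⟨ +↔⊎ ⟩
      (Fin (hubs (suc d)) ⊎ Fin (nodes d + nodes d))
        ↔⟨ hub↔ (suc d) ⊎-↔ ↔-trans +↔⊎ (node↔ d ⊎-↔ node↔ d) ⟩
      (Hub (suc d) ⊎ (Node d ⊎ Node d))         ↔⟨ mk↔ₛ′ to from to-from from-to ⟨
      Node (suc d)                              ∎
      where
      to : Node (suc d) → Hub (suc d) ⊎ (Node d ⊎ Node d)
      to (hub h) = inj₁ h
      to (L x)   = inj₂ (inj₁ x)
      to (R x)   = inj₂ (inj₂ x)
      from : Hub (suc d) ⊎ (Node d ⊎ Node d) → Node (suc d)
      from (inj₁ h)        = hub h
      from (inj₂ (inj₁ x)) = L x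
      from (inj₂ (inj₂ x)) = R x
      to-from : ∀ y → to (from y) ≡ y
      to-from (inj₁ _)        = refl
      to-from (inj₂ (inj₁ _)) = refl
      to-from (inj₂ (inj₂ _)) = refl
      from-to : ∀ x → from (to x) ≡ x
      from-to (hub _) = refl
      from-to (L _)   = refl
      from-to (R _)   = refl

    vertex↔ : ∀ E → Fin (vertices E) ↔ Vertex E
    vertex↔ E = begin
      Fin (nodes E + hubs E * S)          ↔⟨ +↔⊎ ⟩
      (Fin (nodes E) ⊎ Fin (hubs E * S))  ↔⟨ node↔ E ⊎-↔ ↔-trans *↔× (hub↔ E ×-↔ bits↔ (C + C)) ⟩
      (Node E ⊎ (Hub E × Sel))            ↔⟨ mk↔ₛ′ to from to-from from-to ⟨
      Vertex E                            ∎
      where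
      to : Vertex E → Node E ⊎ (Hub E × Sel)
      to (node x)       = inj₁ x
      to (terminal h s) = inj₂ (h , s)
      from : Node E ⊎ (Hub E × Sel) → Vertex E
      from (inj₁ x)       = node x
      from (inj₂ (h , s)) = terminal h s
      to-from : ∀ y → to (from y) ≡ y
      to-from (inj₁ _) = refl
      to-from (inj₂ _) = refl
      from-to : ∀ x → from (to x) ≡ x
      from-to (node _)       = refl
      from-to (terminal _ _) = refl

  module _ (C≥1 : 1 ≤ C) where

    S≥2 : 2 ≤ S
    S≥2 = ^-monoʳ-≤ 2 (≤-trans C≥1 (m≤m+n C C))

    hubs≥1 : ∀ d → 1 ≤ hubs d
    hubs≥1 zero    = ≤-refl
    hubs≥1 (suc d) = *-mono-≤ hS≥1 hS≥1
      where hS≥1 = *-mono-≤ (hubs≥1 d) (≤-trans (s≤s z≤n) S≥2)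

    -- hubs d · S² = S ^ 2^(d+1): the two choices of (hub , selector) square
    hubs-exact : ∀ d → hubs d * (S * S) ≡ S ^ 2 ^ suc d
    hubs-exact zero    = square S
      where
      square : ∀ x → 1 * (x * x) ≡ x * (x * 1)
      square = solve-∀
    hubs-exact (suc d) = begin
      ((hubs d * S) * (hubs d * S)) * (S * S)     ≡⟨ square-rearrange (hubs d) S ⟩
      (hubs d * (S * S)) * (hubs d * (S * S))     ≡⟨ cong₂ _*_ (hubs-exact d) (hubs-exact d) ⟩
      S ^ 2 ^ suc d * S ^ 2 ^ suc d               ≡⟨ ^-distribˡ-+-* S (2 ^ suc d) (2 ^ suc d) ⟨
      S ^ (2 ^ suc d + 2 ^ suc d)                 ≡⟨ cong (λ e → S ^ (2 ^ suc d + e)) (+-identityʳ (2 ^ suc d)) ⟨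
      S ^ 2 ^ suc (suc d)                         ∎
      where
      open ≡-Reasoning
      square-rearrange : ∀ h s → ((h * s) * (h * s)) * (s * s) ≡ (h * (s * s)) * (h * (s * s))
      square-rearrange = solve-∀

    -- each level-(d+1) gadget has at least as many hubs as its two copies have vertices
    nodes≤2hubs : ∀ d → nodes d ≤ 2 * hubs d
    nodes≤2hubs zero    = s≤s z≤n
    nodes≤2hubs (suc d) = begin
      hubs (suc d) + (nodes d + nodes d)
        ≤⟨ +-monoʳ-≤ (hubs (suc d)) (+-mono-≤ (nodes≤2hubs d) (nodes≤2hubs d)) ⟩
      hubs (suc d) + (2 * hubs d + 2 * hubs d)  ≤⟨ +-monoʳ-≤ (hubs (suc d)) copies≤hubs ⟩
      hubs (suc d) + hubs (suc d)               ≡⟨ cong (hubs (suc d) +_) (+-identityʳ (hubs (suc d))) ⟨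
      2 * hubs (suc d)                          ∎
      where
      open ≤-Reasoning
      hS = hubs d * S
      copies≤hubs : 2 * hubs d + 2 * hubs d ≤ hS * hS
      copies≤hubs = begin
        2 * hubs d + 2 * hubs d ≡⟨ four-times (hubs d) ⟩
        hubs d * (2 * 2)        ≤⟨ *-monoʳ-≤ (hubs d) (*-mono-≤ S≥2 S≥2) ⟩
        hubs d * (S * S)        ≡⟨ *-assoc (hubs d) S S ⟨
        hS * S                  ≤⟨ *-monoʳ-≤ hS (m≤n*m S (hubs d) {{>-nonZero (hubs≥1 d)}}) ⟩
        hS * hS                 ∎
        where
        four-times : ∀ h → 2 * h + 2 * h ≡ h * (2 * 2)
        four-times = solve-∀

    vertices≤ : ∀ E → vertices E ≤ 2 ^ (C * 2 ^ (suc E + 1))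
    vertices≤ E = begin
      nodes E + hubs E * S        ≤⟨ +-monoˡ-≤ (hubs E * S) (nodes≤2hubs E) ⟩
      2 * hubs E + hubs E * S     ≡⟨ cong (_+ hubs E * S) (*-comm 2 (hubs E)) ⟩
      hubs E * 2 + hubs E * S     ≡⟨ *-distribˡ-+ (hubs E) 2 S ⟨
      hubs E * (2 + S)            ≤⟨ *-monoʳ-≤ (hubs E) (2+S≤S*S) ⟩
      hubs E * (S * S)            ≡⟨ hubs-exact E ⟩
      S ^ 2 ^ suc E               ≡⟨ ^-*-assoc 2 (C + C) (2 ^ suc E) ⟩
      2 ^ ((C + C) * 2 ^ suc E)   ≡⟨ cong (2 ^_) (exponent C (2 ^ suc E)) ⟩
      2 ^ (C * (2 ^ suc E * 2))   ≡⟨ cong (λ e → 2 ^ (C * e)) (^-distribˡ-+-* 2 (suc E) 1) ⟨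
      2 ^ (C * 2 ^ (suc E + 1))   ∎
      where
      open ≤-Reasoning
      exponent : ∀ c x → (c + c) * x ≡ c * (x * 2)
      exponent = solve-∀
      2+S≤S*S : 2 + S ≤ S * S
      2+S≤S*S = begin
        2 + S   ≤⟨ +-monoˡ-≤ S S≥2 ⟩
        S + S   ≡⟨ cong (S +_) (*-identityˡ S) ⟨
        2 * S   ≤⟨ *-monoˡ-≤ S S≥2 ⟩
        S * S   ∎

halves≤ : ∀ C → ⌊ C /2⌋ + ⌊ C /2⌋ ≤ C
halves≤ C = begin
  ⌊ C /2⌋ + ⌊ C /2⌋ ≤⟨ +-monoʳ-≤ ⌊ C /2⌋ (⌊n/2⌋≤⌈n/2⌉ C) ⟩
  ⌊ C /2⌋ + ⌈ C /2⌉ ≡⟨ ⌊n/2⌋+⌈n/2⌉≡n C ⟩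
  C ∎
  where open ≤-Reasoning

≤-double-suc-half : ∀ C → C ≤ 2 * suc ⌊ C /2⌋
≤-double-suc-half C = begin
  C                          ≡⟨ ⌊n/2⌋+⌈n/2⌉≡n C ⟨
  ⌊ C /2⌋ + ⌈ C /2⌉          ≤⟨ +-monoʳ-≤ ⌊ C /2⌋ (⌊n/2⌋-mono (n≤1+n (suc C))) ⟩
  ⌊ C /2⌋ + suc ⌊ C /2⌋      ≤⟨ n≤1+n _ ⟩
  suc ⌊ C /2⌋ + suc ⌊ C /2⌋  ≡⟨ cong (suc ⌊ C /2⌋ +_) (+-identityʳ (suc ⌊ C /2⌋)) ⟨
  2 * suc ⌊ C /2⌋ ∎
  where open ≤-Reasoning

two-sides : ∀ {C H a b} → H + H ≤ C → C ≤ a + H → C ≤ b + H → C ≤ a + b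
two-sides {C} {H} {a} {b} 2H≤C Ca Cb = +-cancelʳ-≤ C C (a + b) (begin
  C + C               ≤⟨ +-mono-≤ Ca Cb ⟩
  (a + H) + (b + H)   ≡⟨ shuffle a b H ⟩
  (a + b) + (H + H)   ≤⟨ +-monoʳ-≤ (a + b) 2H≤C ⟩
  (a + b) + C ∎)
  where
  open ≤-Reasoning
  shuffle : ∀ a b h → (a + h) + (b + h) ≡ (a + b) + (h + h)
  shuffle = solve-∀

one-side : ∀ {C H a} → 1 ≤ C → H + H ≤ C → C ≤ a + H → 1 ≤ a
one-side {C} {H} {zero} C≥1 2H≤C C≤H = contradiction 2H≤C (<⇒≱ (begin-strict
  C           ≤⟨ C≤H ⟩
  H           ≡⟨ +-identityʳ H ⟨
  H + 0       <⟨ +-monoʳ-< H (≤-trans C≥1 C≤H) ⟩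
  H + H ∎))
  where open ≤-Reasoning
one-side {a = suc a} _ _ _ = s≤s z≤n

rounds-bound : ∀ {C D H len} → C ≤ 2 * suc H → D * suc H ≤ len → C * D ≤ 2 * len
rounds-bound {C} {D} {H} {len} C≤ late = begin
  C * D              ≤⟨ *-monoˡ-≤ D C≤ ⟩
  2 * suc H * D      ≡⟨ rearrange (suc H) D ⟩
  2 * (D * suc H)    ≤⟨ *-monoʳ-≤ 2 late ⟩
  2 * len ∎
  where
  open ≤-Reasoning
  rearrange : ∀ h d → 2 * h * d ≡ 2 * (d * h)
  rearrange = solve-∀

module Network (C E n : ℕ) (C≥1 : 1 ≤ C) (fits : Counts.vertices C E ≤ n) where
  open Gadget C
  open Counts C using (vertex↔; tree↔)
  open UnionGraph (forest E) (vertex↔ E) fits (tree↔ E) public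
  private
    module F = Forest (forest E)

  enter-terminal : ∀ {h s t} → t ∈ out h s → ChildIn (forest E) t (terminal h s) (node (hub h))
  enter-terminal t∈ = ∈ᵇ-complete t∈ , (λ ()) , refl

  full-terminal : Σ (Hub E) λ h → Σ Sel λ s → length (out h s) ≡ C × Σ (Tree E) (_∈ out h s)
  full-terminal with saturated E
  ... | h , s , length-C = h , s , length-C , nonempty (subst (1 ≤_) (sym length-C) C≥1)

  congestion : HasCongestion multicast C
  congestion with full-terminal
  ... | h , s , length-C , t , t∈ =
    (λ u v _ → load-≤ C via via-complete via-length u v) ,
    enc (node (hub h)) , enc (terminal h s) , adjacent-enc (enter-terminal {h} {s} t∈) ,
    ≤-antisym (load-≤ C via via-complete via-length _ _)
              (subst (_≤ load multicast (enc (node (hub h))) (enc (terminal h s))) length-C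
                (load-≥ (out h s) (out-unique h s) (enter-terminal {h} {s})))

  dilation : HasDilation multicast (suc E)
  dilation with full-terminal
  ... | h , s , _ , t , t∈ =
    (λ i v _ → level′-≤ level-≤ v) ,
    index t , enc (terminal h s) , trans (member-index t (terminal h s)) (∈ᵇ-complete t∈) ,
    level′-enc (terminal h s)

  -- terminals are leaves: every parent is a node of the gadget
  terminal-leaf : ∀ t {h s} → F.member t (terminal h s) ≡ true → IsLeaf (tree multicast (index t)) (enc (terminal h s))
  terminal-leaf t {h} {s} mem = trans (member-index t (terminal h s)) mem , no-child
    where
    parent-not-terminal : ∀ y → terminal h s ≢ F.parent t y
    parent-not-terminal (node _)       ()
    parent-not-terminal (terminal _ _) ()
    no-child : ∀ u → isChildOf (tree multicast (index t)) u (enc (terminal h s)) ≡ false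
    no-child u with isChildOf (tree multicast (index t)) u (enc (terminal h s)) in c
    ... | false = refl
    ... | true with child-decode t (subst (λ T → ChildOf T u (enc (terminal h s))) (tree-index t)
                                           (child-spec (tree multicast (index t)) c))
    ...   | y , _ , p≡ , _ = contradiction (enc-injective p≡) (parent-not-terminal y)

  enter-hub : ∀ {d} (p : Pos E (suc d)) y {t} → t ∈ In y →
    ChildIn (forest E) (embT p t) (node (embN p (hub y))) (node (embN p (parentN t (hub y))))
  enter-hub {d} p y {t} t∈ =
    trans (embed-member p t (hub y)) (∈ᵇ-complete t∈) , non-root , cong node (embed-parent p t (hub y))
    where
    non-root : node (embN p (hub y)) ≢ F.root (embT p t)
    non-root e = 0≢1+n (trans (sym (F.root-level (embT p t))) (trans (cong F.level (sym e)) (embed-level p (hub y))))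

  module Adversary {len : ℕ} (sch : Schedule multicast len) where
    open Schedules multicast sch

    H : ℕ
    H = ⌊ C /2⌋

    fresh : ℕ → Vertex E → Tree E → Bool
    fresh T v t = not (crossesWithin T H (enc v) (index t))

    fresh-arrival : ∀ {t v w} T → ChildIn (forest E) t v w → Late (index t) (enc w) T →
                    fresh T v t ≡ true → Late (index t) (enc v) (suc H + T)
    fresh-arrival {t} T c late f =
      late-arrival T H (index t) (childOf-index c) late (trans (sym (not-involutive _)) (cong not f))

    many-fresh : ∀ {A : Set} T {v w} (ι : A → Tree E) {xs : List A} → Unique xs →
      (∀ {x y} → ι x ≡ ι y → x ≡ y) → (∀ {x} → x ∈ xs → ChildIn (forest E) (ι x) v w) →
      length xs ≡ C → C ≤ length (filterᵇ (fresh T v ∘ ι) xs) + H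
    many-fresh T {v} {w} ι xs! ι-inj enters =
      many-late C T H (enc w) (enc v) (index ∘ ι) xs! (ι-inj ∘ index-injective)
        (λ x∈ → proj₂ (proj₂ (childOf-index (enters x∈))))

    Found : ∀ {d} → Pos E d → ℕ → Set
    Found {d} p T = Σ (Hub d) λ h → Σ Sel λ s → length (out h s) ≡ C ×
                    (∀ {t} → t ∈ out h s → Late (index (embT p t)) (enc (node (embN p (hub h)))) T)

    -- Combining the hubs found in the two halves of a copy: of the C trees
    -- leaving each, at most H cross into the combining hub within H rounds,
    -- and the at least 2(C - H) ≥ C others can all be forwarded.
    grow : ∀ {d} (p : Pos E (suc d)) T → Found (inL p) T → Found (inR p) T → Found p (suc H + T)
    grow {d} p T (h₁ , s₁ , length₁ , late₁) (h₂ , s₂ , length₂ , late₂) =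
      y , proj₁ chosen , proj₁ (proj₂ chosen) , arrives
      where
      y = comb h₁ s₁ h₂ s₂
      b = node (embN p (hub y))
      fresh? : Tree (suc d) → Bool
      fresh? t = fresh T b (embT p t)
      split : length (filterᵇ fresh? (In y)) ≡
              length (filterᵇ (fresh? ∘ inj₁) (out h₁ s₁)) + length (filterᵇ (fresh? ∘ inj₂) (out h₂ s₂))
      split = begin
        length (filterᵇ fresh? (map inj₁ (out h₁ s₁) ++ map inj₂ (out h₂ s₂)))
          ≡⟨ cong length (filter-++ (T? ∘ fresh?) (map inj₁ (out h₁ s₁)) (map inj₂ (out h₂ s₂))) ⟩
        length (filterᵇ fresh? (map inj₁ (out h₁ s₁)) ++ filterᵇ fresh? (map inj₂ (out h₂ s₂)))
          ≡⟨ length-++ (filterᵇ fresh? (map inj₁ (out h₁ s₁))) ⟩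
        length (filterᵇ fresh? (map inj₁ (out h₁ s₁))) + length (filterᵇ fresh? (map inj₂ (out h₂ s₂)))
          ≡⟨ cong₂ _+_ (length-filterᵇ-map fresh? inj₁ (out h₁ s₁))
                       (length-filterᵇ-map fresh? inj₂ (out h₂ s₂)) ⟩
        length (filterᵇ (fresh? ∘ inj₁) (out h₁ s₁)) + length (filterᵇ (fresh? ∘ inj₂) (out h₂ s₂)) ∎
        where open ≡-Reasoning
      enough : C ≤ length (filterᵇ fresh? (In y))
      enough = subst (C ≤_) (sym split) (two-sides {H = H} (halves≤ C)
        (many-fresh T (embT p ∘ inj₁) (out-unique h₁ s₁) (inj₁-injective ∘ embT-injective p)
           (λ x∈ → enter-hub p y (∈-++⁺ˡ (∈-map⁺ inj₁ x∈))) length₁)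
        (many-fresh T (embT p ∘ inj₂) (out-unique h₂ s₂) (inj₂-injective ∘ embT-injective p)
           (λ x∈ → enter-hub p y (∈-++⁺ʳ (map inj₁ (out h₁ s₁)) (∈-map⁺ inj₂ x∈))) length₂))
      chosen = select y fresh? enough
      parent-late : ∀ {t} → t ∈ In y → Late (index (embT p t)) (enc (node (embN p (parentN t (hub y))))) T
      parent-late {inj₁ t} t∈ = late₁ (In-inj₁ {h₁ = h₁} {h₂} {s₁} {s₂} t∈)
      parent-late {inj₂ t} t∈ = late₂ (In-inj₂ {h₁ = h₁} {h₂} {s₁} {s₂} t∈)
      arrives : ∀ {t} → t ∈ out y (proj₁ chosen) → Late (index (embT p t)) (enc b) (suc H + T)
      arrives t∈ = let t∈In , is-fresh = proj₂ (proj₂ chosen) t∈ in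
        fresh-arrival T (enter-hub p y t∈In) (parent-late t∈In) is-fresh

    claim : ∀ d (p : Pos E d) → Found p (d * suc H)
    claim zero    p = let h , s , length-C = saturated 0 in h , s , length-C , λ _ _ _ → z≤n
    claim (suc d) p = grow p (d * suc H) (claim d (inL p)) (claim d (inR p))

    -- At the top, C trees leave a hub h of level E towards the terminal
    -- (h , s); at least C - H ≥ 1 of them reach it only after round
    -- (E + 1)(H + 1), and the terminal is a leaf, so delivery takes that long.
    finish : Found top (E * suc H) → C * suc E ≤ 2 * len
    finish (h , s , length-C , late) =
      rounds-bound (≤-double-suc-half C) (arrival len (Schedule.delivered sch (index t) (enc v) leaf))
      where
      v = terminal h s
      late-trees = filterᵇ (fresh (E * suc H) v) (out h s)
      some-late : 1 ≤ length late-trees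
      some-late = one-side C≥1 (halves≤ C)
        (many-fresh (E * suc H) id (out-unique h s) id (enter-terminal {h} {s}) length-C)
      t = proj₁ (nonempty {xs = late-trees} some-late)
      t∈late = ∈-filter⁻ (T? ∘ fresh (E * suc H) v) {xs = out h s} (proj₂ (nonempty {xs = late-trees} some-late))
      arrival : Late (index t) (enc v) (suc E * suc H)
      arrival = fresh-arrival (E * suc H) (enter-terminal (proj₁ t∈late)) (late (proj₁ t∈late))
                              (Equivalence.to T-≡ (proj₂ t∈late))
      leaf : IsLeaf (tree multicast (index t)) (enc v)
      leaf = terminal-leaf t (∈ᵇ-complete (proj₁ t∈late))

    lower-bound : C * suc E ≤ 2 * len
    lower-bound = finish (claim E top)

theorem1 : (C D n : ℕ) → 1 ≤ C → 1 ≤ D → 1 ≤ n →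
           2 ^ (C * 2 ^ (D + 1)) ≤ n →
           Σ (Graph n) λ G → Σ (Instance G) λ I →
             HasCongestion I C × HasDilation I D ×
             ((len : ℕ) → Schedule I len → C * D ≤ 2 * len)
theorem1 C zero    n _   () _ _
theorem1 C (suc E) n C≥1 _  _ big =
  graph , multicast , congestion , dilation , λ _ sch → Adversary.lower-bound sch
  where
  open Network C E n C≥1 (≤-trans (Counts.vertices≤ C C≥1 E) big)
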